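{- Let $u$ be a word and let $v$ be a run in $u$ with shortest period $p$ and exponent $e$. If $p=1$ then $e=|H(v)|+1$. If $p\ge 2$ then $\lceil e\rceil \le \frac{|H(v)|}{2}+3$.
   Context: For a word $u=u_1\cdots u_m$, $u[i..j]=u_i\cdots u_j$. The shortest period of a word $x$ of length $m$ is the smallest positive integer $p$ with $x_i=x_{i+p}$ for all $1\le i\le m-p$. A run in $u$ is an interval $[i..j]$ such that the shortest period $p$ of $u[i..j]$ satisfies $2p\le j-i+1$ and (whenever the indices exist) $u[i-1]\ne u[i+p-1]$ and $u[j-p+1]\ne u[j+1]$; its exponent is $(j-i+1)/p$. Two words $x,y$ are cyclically equivalent if $x=st$ and $y=ts$ for some words $s,t$. The inter-positions of $u$ are the $|u|-1$ places between consecutive letters of $u$. Handles: for a run $v$ with shortest period $p$, let $w$ be the prefix of (the factor of) $v$ of length $p$, and let $w_{\min}$, $w_{\max}$ be the lexicographically minimal and maximal words cyclically equivalent to $w$. The set $H(v)$ of handles of $v$ is: (a) if $w_{\min}=w_{\max}$, the set of all inter-positions inside $v$ (i.e. between two consecutive letters both belonging to $v$); (b) if $w_{\min}\ne w_{\max}$, the set of inter-positions lying between two consecutive occurrences of $w_{\min}$ within $v$ or between two consecutive occurrences of $w_{\max}$ within $v$ (consecutive occurrences meaning adjacent occurrences $xy$ with $x=y=w_{\min}$, resp. $w_{\max}$, the inter-position being the one between them). -}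

module Defs where

-- Words are lists over an alphabet A; positions are 0-based
-- (position k of the paper's 1-based word u_1..u_m is index k-1 here).

open import Level using (0ℓ)
open import Data.Nat using (ℕ; zero; suc; _+_; _*_; _∸_; _≤_; _<_)
open import Data.List using (List; []; _∷_; _++_; length; take; drop)
open import Data.Maybe using (Maybe; just; nothing)
open import Data.Product using (Σ; ∃; ∃-syntax; _×_; _,_)
open import Data.Sum using (_⊎_)
open import Relation.Nullary using (¬_)
open import Relation.Binary.Core using (Rel)
open import Relation.Binary.PropositionalEquality using (_≡_; _≢_)
open import Data.List.Relation.Binary.Lex.Strict using (Lex-≤)

at : {A : Set} → List A → ℕ → Maybe A
at []       _       = nothing
at (x ∷ xs) zero    = just x
at (x ∷ xs) (suc k) = at xs k

factor : {A : Set} → List A → ℕ → ℕ → List A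
factor u i j = take (suc j ∸ i) (drop i u)

IsPeriod : {A : Set} → List A → ℕ → Set
IsPeriod x p = 1 ≤ p × (∀ k → k + p < length x → at x k ≡ at x (k + p))

IsShortestPeriod : {A : Set} → List A → ℕ → Set
IsShortestPeriod x p = IsPeriod x p × (∀ q → IsPeriod x q → p ≤ q)

IsRun : {A : Set} → List A → ℕ → ℕ → ℕ → Set
IsRun u i j p =
  i ≤ j × j < length u
  × IsShortestPeriod (factor u i j) p
  × 2 * p ≤ suc j ∸ i
  × (1 ≤ i → at u (i ∸ 1) ≢ at u (i + p ∸ 1))
  × (suc j < length u → at u (suc j ∸ p) ≢ at u (suc j))

CycEq : {A : Set} → List A → List A → Set
CycEq x y = ∃[ s ] ∃[ t ] (x ≡ s ++ t × y ≡ t ++ s)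

IsLexMinRot : {A : Set} → Rel A 0ℓ → List A → List A → Set
IsLexMinRot _<_ w wmin = CycEq w wmin × (∀ y → CycEq w y → Lex-≤ _≡_ _<_ wmin y)

IsLexMaxRot : {A : Set} → Rel A 0ℓ → List A → List A → Set
IsLexMaxRot _<_ w wmax = CycEq w wmax × (∀ y → CycEq w y → Lex-≤ _≡_ _<_ y wmax)

-- Inter-position k (0-based) is the place between positions k and k+1 of u.
-- It lies inside the run [i..j] iff i ≤ k and k + 1 ≤ j.
InsideInter : ℕ → ℕ → ℕ → Set
InsideInter i j k = i ≤ k × suc k ≤ j

-- inter-position k lies between two consecutive (adjacent) occurrences
-- x x of the word x inside the factor u[i..j]: the occurrence x x starts
-- at position s ≥ i, ends at s + 2|x| - 1 ≤ j, and k is between them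
-- (positions s+|x|-1 and s+|x|).
BetweenConsecOcc : {A : Set} → List A → ℕ → ℕ → List A → ℕ → Set
BetweenConsecOcc u i j x k =
  ∃[ s ] (i ≤ s × s + 2 * length x ≤ suc j × s + length x ≡ suc k
          × take (2 * length x) (drop s u) ≡ x ++ x)

-- k ∈ H(v) for the run v = [i..j] with shortest period p, where
-- wmin / wmax are the lexicographically minimal / maximal words
-- cyclically equivalent to w = prefix of length p of v.
IsHandle : {A : Set} → List A → ℕ → ℕ → List A → List A → ℕ → Set
IsHandle u i j wmin wmax k =
  InsideInter i j k
  × (wmin ≡ wmax
     ⊎ (wmin ≢ wmax
        × (BetweenConsecOcc u i j wmin k ⊎ BetweenConsecOcc u i j wmax k)))

IsCeilDiv : ℕ → ℕ → ℕ → Set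
IsCeilDiv n p c = n ≤ c * p × (∀ d → n ≤ d * p → c ≤ d)

-- If w_min = w_max, in particular when p = 1, every inter-position inside v is a
-- handle, so |H(v)| = |v| - 1. Otherwise w_min and w_max, being rotations of w,
-- occur in v at offsets r₁, r₂ < p and, by periodicity, at every offset r + a p;
-- each square w_min w_min (resp. w_max w_max) fitting in v yields the handle in
-- its middle, and there are at least ⌈e⌉ - 3 of each. The two families are
-- disjoint because r₁ ≢ r₂ (mod p): a factor of length p of v is determined by
-- its offset modulo p.

module Submission where

open import Defs
open import Level using (0ℓ)
open import Data.Nat using (ℕ; zero; suc; _+_; _*_; _∸_; _≤_; _<_; z≤n; s≤s; s≤s⁻¹; _<?_; _%_; NonZero)
open import Data.Nat.Properties
open import Data.Nat.DivMod using ([m+kn]%n≡m%n; m<n⇒m%n≡m)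
open import Data.Nat.Tactic.RingSolver using (solve-∀)
open import Algebra.Properties.CommutativeSemigroup +-commutativeSemigroup using (xy∙z≈xz∙y)
open import Data.List using (List; []; _∷_; _++_; length; take; drop; applyUpTo)
open import Data.List.Properties
  using (length-++; length-take; length-drop; length-applyUpTo; length-removeAt′; ++-identityʳ; ≡-dec)
import Data.List.Relation.Unary.All as All
open import Data.List.Relation.Unary.Any using (here; there; index; _─_)
open import Data.List.Relation.Unary.AllPairs using ([]; _∷_)
open import Data.List.Relation.Unary.Unique.Propositional using (Unique)
open import Data.List.Relation.Unary.Unique.Propositional.Properties using (applyUpTo⁺₁; ++⁺)
open import Data.List.Relation.Binary.Subset.Propositional using (_⊆_)
open import Data.List.Membership.Propositional using (_∈_)
open import Data.List.Membership.Propositional.Properties using (∈-applyUpTo⁺; ∈-applyUpTo⁻; ∈-++⁻)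
open import Data.Maybe using (nothing)
open import Data.Product using (_×_; _,_; proj₁; proj₂; ∃-syntax)
open import Data.Sum as Sum using (_⊎_; inj₁; inj₂)
open import Function.Bundles using (_⇔_; Equivalence)
open import Relation.Binary.Core using (Rel)
open import Relation.Binary.Structures using (IsStrictTotalOrder)
open import Relation.Binary.PropositionalEquality
open import Relation.Nullary using (¬_; yes; no; contradiction)

module _ {A : Set} where

  at-take< : ∀ (xs : List A) {n k} → k < n → at (take n xs) k ≡ at xs k
  at-take< []       {suc n}         _         = refl
  at-take< (x ∷ xs) {suc n} {zero}  _         = refl
  at-take< (x ∷ xs) {suc n} {suc k} (s≤s k<n) = at-take< xs k<n

  at-take≥ : ∀ (xs : List A) {n k} → n ≤ k → at (take n xs) k ≡ nothing
  at-take≥ xs       {zero}          _         = refl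
  at-take≥ []       {suc n}         _         = refl
  at-take≥ (x ∷ xs) {suc n} {suc k} (s≤s n≤k) = at-take≥ xs n≤k

  at-drop : ∀ (xs : List A) n k → at (drop n xs) k ≡ at xs (n + k)
  at-drop xs       zero    k = refl
  at-drop []       (suc n) k = refl
  at-drop (x ∷ xs) (suc n) k = at-drop xs n k

  at-++ˡ : ∀ (xs ys : List A) {k} → k < length xs → at (xs ++ ys) k ≡ at xs k
  at-++ˡ (x ∷ xs) ys {zero}  _         = refl
  at-++ˡ (x ∷ xs) ys {suc k} (s≤s k<n) = at-++ˡ xs ys k<n

  at-++ʳ : ∀ (xs ys : List A) k → at (xs ++ ys) (length xs + k) ≡ at ys k
  at-++ʳ []       ys k = refl
  at-++ʳ (x ∷ xs) ys k = at-++ʳ xs ys k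

  at-length≤ : ∀ (xs : List A) {k} → length xs ≤ k → at xs k ≡ nothing
  at-length≤ []       _         = refl
  at-length≤ (x ∷ xs) (s≤s n≤k) = at-length≤ xs n≤k

  at-extensionality : ∀ {xs ys : List A} → (∀ k → at xs k ≡ at ys k) → xs ≡ ys
  at-extensionality {[]}     {[]}     _ = refl
  at-extensionality {[]}     {y ∷ ys} f with () ← f 0
  at-extensionality {x ∷ xs} {[]}     f with () ← f 0
  at-extensionality {x ∷ xs} {y ∷ ys} f with refl ← f 0 =
    cong (x ∷_) (at-extensionality (λ k → f (suc k)))

  length-take-≤ : ∀ {n} {xs : List A} → n ≤ length xs → length (take n xs) ≡ n
  length-take-≤ {n} {xs} n≤xs = trans (length-take n xs) (m≤n⇒m⊓n≡m n≤xs)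

  cyclic-length : ∀ {x y : List A} → CycEq x y → length y ≡ length x
  cyclic-length (s , t , refl , refl) =
    trans (length-++ t) (trans (+-comm (length t) (length s)) (sym (length-++ s)))

  cyclic-length-one : ∀ {x y : List A} → length x ≡ 1 → CycEq x y → y ≡ x
  cyclic-length-one _  ([]        , t     , refl , refl) = ++-identityʳ t
  cyclic-length-one _  (_ ∷ []    , []    , refl , refl) = refl
  cyclic-length-one () (_ ∷ []    , _ ∷ _ , refl , refl)
  cyclic-length-one () (_ ∷ _ ∷ _ , _     , refl , refl)

module _ {A : Set} where

  record OccursAt (v : List A) (o : ℕ) (z : List A) : Set where
    constructor occurs
    field letter : ∀ k → k < length z → at v (o + k) ≡ at z k

  open OccursAt public

  take-drop-occurrence : ∀ {v o} {z : List A} → OccursAt v o z → take (length z) (drop o v) ≡ z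
  take-drop-occurrence {v} {o} {z} occ = at-extensionality pointwise
    where
    pointwise : ∀ k → at (take (length z) (drop o v)) k ≡ at z k
    pointwise k with k <? length z
    ... | yes k<z = trans (at-take< (drop o v) k<z) (trans (at-drop v o k) (letter occ k k<z))
    ... | no  k≮z = trans (at-take≥ (drop o v) (≮⇒≥ k≮z)) (sym (at-length≤ z (≮⇒≥ k≮z)))

  occurrence-unique : ∀ {v o} {y z : List A} → OccursAt v o y → OccursAt v o z →
                      length y ≡ length z → y ≡ z
  occurrence-unique {v} {o} occ-y occ-z |y|≡|z| =
    trans (sym (take-drop-occurrence occ-y))
          (trans (cong (λ n → take n (drop o v)) |y|≡|z|) (take-drop-occurrence occ-z))

  occurs-take : ∀ (v : List A) n → OccursAt v 0 (take n v)
  occurs-take v n = occurs λ k k<len →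
    sym (at-take< v (m<n⊓o⇒m<n n (length v) (subst (k <_) (length-take n v) k<len)))

  occurs-++⁻ : ∀ {v o} {y z : List A} → OccursAt v o (y ++ z) →
               OccursAt v o y × OccursAt v (o + length y) z
  occurs-++⁻ {v} {o} {y} {z} occ = occurs occ-y , occurs occ-z
    where
    |y++z| : length (y ++ z) ≡ length y + length z
    |y++z| = length-++ y

    occ-y : ∀ k → k < length y → at v (o + k) ≡ at y k
    occ-y k k<y =
      trans (letter occ k (<-≤-trans k<y (subst (length y ≤_) (sym |y++z|) (m≤m+n _ _))))
            (at-++ˡ y z k<y)

    occ-z : ∀ k → k < length z → at v (o + length y + k) ≡ at z k
    occ-z k k<z =
      trans (cong (at v) (+-assoc o (length y) k))
            (trans (letter occ (length y + k) (subst (length y + k <_) (sym |y++z|) (+-monoʳ-< (length y) k<z)))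
                   (at-++ʳ y z k))

  occurs-++⁺ : ∀ {v o} {y z : List A} → OccursAt v o y → OccursAt v (o + length y) z →
               OccursAt v o (y ++ z)
  occurs-++⁺ {v} {o} {y} {z} occ-y occ-z = occurs pointwise
    where
    pointwise : ∀ k → k < length (y ++ z) → at v (o + k) ≡ at (y ++ z) k
    pointwise k k<len with k <? length y
    ... | yes k<y = trans (letter occ-y k k<y) (sym (at-++ˡ y z k<y))
    ... | no  k≮y with b , refl ← m≤n⇒∃[o]m+o≡n (≮⇒≥ k≮y) =
      trans (cong (at v) (sym (+-assoc o (length y) b)))
            (trans (letter occ-z b b<z) (sym (at-++ʳ y z b)))
      where
      b<z : b < length z
      b<z = +-cancelˡ-< (length y) b (length z) (subst (length y + b <_) (length-++ y) k<len)

module _ {A : Set} {v : List A} {p : ℕ} (period : IsPeriod v p) where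

  occurs-+period : ∀ {o z} → OccursAt v o z → o + p + length z ≤ length v → OccursAt v (o + p) z
  occurs-+period {o} {z} occ bound = occurs shifted
    where
    open ≡-Reasoning
    o+p+k≡o+k+p : ∀ k → o + p + k ≡ o + k + p
    o+p+k≡o+k+p = xy∙z≈xz∙y o p

    shifted : ∀ k → k < length z → at v (o + p + k) ≡ at z k
    shifted k k<z = begin
      at v (o + p + k) ≡⟨ cong (at v) (o+p+k≡o+k+p k) ⟩
      at v (o + k + p) ≡⟨ sym (proj₂ period (o + k) (subst (_< length v) (o+p+k≡o+k+p k) o+p+k<v)) ⟩
      at v (o + k)     ≡⟨ letter occ k k<z ⟩
      at z k           ∎
      where
      o+p+k<v : o + p + k < length v
      o+p+k<v = <-≤-trans (+-monoʳ-< (o + p) k<z) bound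

  occurs-+periods : ∀ {o z} → OccursAt v o z → ∀ a → o + a * p + length z ≤ length v →
                    OccursAt v (o + a * p) z
  occurs-+periods {o} occ zero    _     = subst (λ x → OccursAt v x _) (sym (+-identityʳ o)) occ
  occurs-+periods {o} {z} occ (suc a) bound =
    subst (λ x → OccursAt v x z) (+-assoc o p (a * p))
      (occurs-+periods (occurs-+period occ bound-p) a bound-a)
    where
    bound-a : o + p + a * p + length z ≤ length v
    bound-a = subst (λ x → x + length z ≤ length v) (sym (+-assoc o p (a * p))) bound
    bound-p : o + p + length z ≤ length v
    bound-p = ≤-trans (+-monoˡ-≤ (length z) (m≤m+n (o + p) (a * p))) bound-a

  occurs-square : ∀ {o z} → OccursAt v o z → length z ≡ p → o + p + p ≤ length v →
                  OccursAt v o (z ++ z)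
  occurs-square occ refl bound = occurs-++⁺ occ (occurs-+period occ bound)

  -- For w = s t, the rotation t s occurs at offset |s|: t follows s in w, and s
  -- recurs one period later.
  rotation-occurs : ∀ {z} → p + p ≤ length v → CycEq (take p v) z → ∃[ r ] r < p × OccursAt v r z
  rotation-occurs bound (s , [] , w≡s++[] , refl) =
    0 , proj₁ period , subst (OccursAt v 0) (trans w≡s++[] (++-identityʳ s)) (occurs-take v p)
  rotation-occurs bound (s , t@(_ ∷ _) , w≡s++t , refl) =
    length s , |s|<p , occurs-++⁺ occ-t occ-s
    where
    |s|+|t| : length s + length t ≡ p
    |s|+|t| = trans (sym (length-++ s))
                    (trans (cong length (sym w≡s++t)) (length-take-≤ (m+n≤o⇒m≤o p bound)))
    |s|<p : length s < p
    |s|<p = subst (length s <_) |s|+|t| (m<m+n (length s) (s≤s z≤n))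
    occ-s++t : OccursAt v 0 (s ++ t)
    occ-s++t = subst (OccursAt v 0) w≡s++t (occurs-take v p)
    occ-t : OccursAt v (length s) t
    occ-t = proj₂ (occurs-++⁻ occ-s++t)
    occ-s : OccursAt v (length s + length t) s
    occ-s = subst (λ o → OccursAt v o s) (sym |s|+|t|)
              (occurs-+period (proj₁ (occurs-++⁻ occ-s++t)) (≤-trans (+-monoʳ-≤ p (<⇒≤ |s|<p)) bound))

module _ {A : Set} {u : List A} {i j : ℕ} where

  length-factor : j < length u → length (factor u i j) ≡ suc j ∸ i
  length-factor j<u = length-take-≤ (subst (suc j ∸ i ≤_) (sym (length-drop i u)) (∸-monoˡ-≤ i j<u))

  occurs-factor : ∀ {o z} → OccursAt (factor u i j) o z → o + length z ≤ suc j ∸ i →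
                  OccursAt u (i + o) z
  occurs-factor {o} occ bound = occurs λ k k<z →
    trans (cong (at u) (+-assoc i o k))
          (trans (sym (at-drop u i (o + k)))
                 (trans (sym (at-take< (drop i u) (<-≤-trans (+-monoʳ-< o k<z) bound))) (letter occ k k<z)))

  between⇒inside : ∀ {x k} → 1 ≤ length x → BetweenConsecOcc u i j x k → InsideInter i j k
  between⇒inside {x} {k} 1≤n (s , i≤s , bound , s+n≡1+k , _) =
    ≤-trans i≤s (s≤s⁻¹ (subst (s <_) s+n≡1+k (m<m+n s 1≤n))) , s≤s⁻¹ 2+k≤1+j
    where
    open ≤-Reasoning
    n = length x
    2+k≤1+j : suc (suc k) ≤ suc j
    2+k≤1+j = begin
      suc (suc k)  ≡⟨ cong suc (sym s+n≡1+k) ⟩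
      suc (s + n)  ≡⟨ +-comm 1 (s + n) ⟩
      s + n + 1    ≤⟨ +-monoʳ-≤ (s + n) 1≤n ⟩
      s + n + n    ≡⟨ +-assoc s n n ⟩
      s + (n + n)  ≡⟨ cong (λ m → s + (n + m)) (sym (+-identityʳ n)) ⟩
      s + 2 * n    ≤⟨ bound ⟩
      suc j        ∎

  square⇒between : ∀ {z s q} → length z ≡ suc q → OccursAt u s (z ++ z) → i ≤ s →
                   s + length (z ++ z) ≤ suc j → BetweenConsecOcc u i j z (s + q)
  square⇒between {z} {s} {q} |z|≡1+q occ i≤s bound =
    s , i≤s , subst (λ n → s + n ≤ suc j) |z++z| bound , trans (cong (s +_) |z|≡1+q) (+-suc s q)
      , subst (λ n → take n (drop s u) ≡ z ++ z) |z++z| (take-drop-occurrence occ)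
    where
    |z++z| : length (z ++ z) ≡ 2 * length z
    |z++z| = trans (length-++ z) (cong (length z +_) (sym (+-identityʳ (length z))))

module _ {B : Set} where

  ∈-─⁺ : ∀ {x z : B} {ys} (x∈ys : x ∈ ys) → z ∈ ys → z ≢ x → z ∈ (ys ─ x∈ys)
  ∈-─⁺ (here refl)  (here refl)  z≢x = contradiction refl z≢x
  ∈-─⁺ (here refl)  (there z∈ys) _   = z∈ys
  ∈-─⁺ (there x∈ys) (here refl)  _   = here refl
  ∈-─⁺ (there x∈ys) (there z∈ys) z≢x = there (∈-─⁺ x∈ys z∈ys z≢x)

  unique-⊆⇒length≤ : ∀ {xs ys : List B} → Unique xs → xs ⊆ ys → length xs ≤ length ys
  unique-⊆⇒length≤ []                        _   = z≤n
  unique-⊆⇒length≤ {x ∷ xs} {ys} (x∉xs ∷ !xs) xs⊆ys =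
    subst (suc (length xs) ≤_) (sym (length-removeAt′ ys (index x∈ys)))
      (s≤s (unique-⊆⇒length≤ !xs xs⊆ys─x))
    where
    x∈ys = xs⊆ys (here refl)
    xs⊆ys─x : xs ⊆ (ys ─ x∈ys)
    xs⊆ys─x z∈xs = ∈-─⁺ x∈ys (xs⊆ys (there z∈xs)) (λ z≡x → All.lookup x∉xs z∈xs (sym z≡x))

  disjoint-injections⇒length≥ : ∀ {H : List B} (f g : ℕ → B) n → Unique H →
    (∀ {a b} → f a ≡ f b → a ≡ b) → (∀ {a b} → g a ≡ g b → a ≡ b) → (∀ a b → f a ≢ g b) →
    (∀ {a} → a < n → f a ∈ H) → (∀ {a} → a < n → g a ∈ H) → n + n ≤ length H
  disjoint-injections⇒length≥ {H} f g n !H f-inj g-inj f≢g f∈H g∈H =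
    subst (_≤ _) |images| (unique-⊆⇒length≤ (++⁺ (unique f f-inj) (unique g g-inj) disjoint) images⊆H)
    where
    images = applyUpTo f n ++ applyUpTo g n

    |images| : length images ≡ n + n
    |images| = trans (length-++ (applyUpTo f n)) (cong₂ _+_ (length-applyUpTo f n) (length-applyUpTo g n))

    unique : ∀ h → (∀ {a b} → h a ≡ h b → a ≡ b) → Unique (applyUpTo h n)
    unique h h-inj = applyUpTo⁺₁ h n (λ a<b _ ha≡hb → <⇒≢ a<b (h-inj ha≡hb))

    disjoint : ∀ {y} → ¬ (y ∈ applyUpTo f n × y ∈ applyUpTo g n)
    disjoint (y∈f , y∈g)
      with a , _ , refl ← ∈-applyUpTo⁻ f y∈f | b , _ , fa≡gb ← ∈-applyUpTo⁻ g y∈g =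
      f≢g a b fa≡gb

    images⊆H : images ⊆ H
    images⊆H y∈ with ∈-++⁻ (applyUpTo f n) y∈
    ... | inj₁ y∈f with a , a<n , refl ← ∈-applyUpTo⁻ f y∈f = f∈H a<n
    ... | inj₂ y∈g with b , b<n , refl ← ∈-applyUpTo⁻ g y∈g = g∈H b<n

ceilDiv-pred< : ∀ {n p c} → IsCeilDiv n p (suc c) → c * p < n
ceilDiv-pred< {c = c} (_ , least) = ≰⇒> (λ n≤cp → n≮n c (least c n≤cp))

ceilDiv-≤-half : ∀ {n p c} → 2 ≤ p → IsCeilDiv n p c → 2 * c ≤ suc n
ceilDiv-≤-half {c = zero}  _   _    = z≤n
ceilDiv-≤-half {n} {c = suc c} 2≤p ceil =
  subst (_≤ suc n) (sym (*-suc 2 c))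
    (s≤s (≤-<-trans (≤-trans (≤-reflexive (*-comm 2 c)) (*-monoʳ-≤ c 2≤p)) (ceilDiv-pred< ceil)))

remainder-unique : ∀ {p r r′} a b .{{_ : NonZero p}} → r < p → r′ < p →
                   r + a * p ≡ r′ + b * p → r ≡ r′
remainder-unique {p} {r} {r′} a b r<p r′<p e = begin
  r                ≡⟨ sym (m<n⇒m%n≡m r<p) ⟩
  r % p            ≡⟨ sym ([m+kn]%n≡m%n r a p) ⟩
  (r + a * p) % p  ≡⟨ cong (_% p) e ⟩
  (r′ + b * p) % p ≡⟨ [m+kn]%n≡m%n r′ b p ⟩
  r′ % p           ≡⟨ m<n⇒m%n≡m r′<p ⟩
  r′               ∎
  where open ≡-Reasoning

window-bound : ∀ {r p a M N} → r < p → a < M → (2 + M) * p < N → r + a * p + p + p ≤ N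
window-bound {r} {p} {a} {M} {N} r<p a<M bound = <⇒≤ (begin-strict
  r + a * p + p + p <⟨ +-monoˡ-< p (+-monoˡ-< p (+-monoˡ-< (a * p) r<p)) ⟩
  p + a * p + p + p ≡⟨ three-periods a p ⟩
  (3 + a) * p       ≤⟨ *-monoˡ-≤ p (s≤s (s≤s a<M)) ⟩
  (2 + M) * p       <⟨ bound ⟩
  N                 ∎)
  where
  open ≤-Reasoning
  three-periods : ∀ a p → p + a * p + p + p ≡ (3 + a) * p
  three-periods = solve-∀

module RunHandles {A : Set} {u : List A} {i j q : ℕ}
  (i≤j : i ≤ j) (j<u : j < length u) (period : IsPeriod (factor u i j) (suc q))
  (2p≤N : 2 * suc q ≤ suc j ∸ i)
  {wmin wmax : List A}
  (wmin-rot : CycEq (take (suc q) (factor u i j)) wmin)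
  (wmax-rot : CycEq (take (suc q) (factor u i j)) wmax)
  {H : List ℕ} (!H : Unique H) (H⇔handle : ∀ k → (k ∈ H) ⇔ IsHandle u i j wmin wmax k)
  where

  p N : ℕ
  p = suc q
  N = suc j ∸ i

  v : List A
  v = factor u i j

  |v|≡N : length v ≡ N
  |v|≡N = length-factor {u = u} {i} j<u

  p+p≤|v| : p + p ≤ length v
  p+p≤|v| = subst₂ _≤_ (cong (p +_) (+-identityʳ p)) (sym |v|≡N) 2p≤N

  |w|≡p : length (take p v) ≡ p
  |w|≡p = length-take-≤ {xs = v} (m+n≤o⇒m≤o p p+p≤|v|)

  inter : List ℕ
  inter = applyUpTo (i +_) (j ∸ i)

  handles⊆inter : H ⊆ inter
  handles⊆inter {k} k∈H with (i≤k , k<j) , _ ← Equivalence.to (H⇔handle k) k∈H =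
    subst (_∈ inter) (m+[n∸m]≡n i≤k) (∈-applyUpTo⁺ (i +_) (∸-monoˡ-< k<j i≤k))

  inter⊆handles : wmin ≡ wmax → inter ⊆ H
  inter⊆handles wmin≡wmax k∈ with a , a<j∸i , refl ← ∈-applyUpTo⁻ (i +_) k∈ =
    Equivalence.from (H⇔handle (i + a))
      ((m≤m+n i a , subst (i + a <_) (m+[n∸m]≡n i≤j) (+-monoʳ-< i a<j∸i)) , inj₁ wmin≡wmax)

  equal-extremes⇒length≡1+handles : wmin ≡ wmax → suc j ∸ i ≡ suc (length H)
  equal-extremes⇒length≡1+handles wmin≡wmax =
    trans (+-∸-assoc 1 i≤j) (cong suc (≤-antisym inter≤H H≤inter))
    where
    !inter : Unique inter
    !inter = applyUpTo⁺₁ (i +_) (j ∸ i) (λ a<b _ → <⇒≢ (+-monoʳ-< i a<b))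
    inter≤H : j ∸ i ≤ length H
    inter≤H = subst (_≤ length H) (length-applyUpTo (i +_) (j ∸ i))
                (unique-⊆⇒length≤ !inter (inter⊆handles wmin≡wmax))
    H≤inter : length H ≤ j ∸ i
    H≤inter = subst (length H ≤_) (length-applyUpTo (i +_) (j ∸ i))
                (unique-⊆⇒length≤ !H handles⊆inter)

  period-one⇒equal-extremes : p ≡ 1 → wmin ≡ wmax
  period-one⇒equal-extremes p≡1 =
    trans (cyclic-length-one |w|≡1 wmin-rot) (sym (cyclic-length-one |w|≡1 wmax-rot))
    where
    |w|≡1 = trans |w|≡p p≡1

  -- The square of z at offset o = r + a p of v is split at the inter-position i + o + q
  -- of u, as p = q + 1.
  square-handle : ∀ {z r} → z ≡ wmin ⊎ z ≡ wmax → wmin ≢ wmax → length z ≡ p →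
                  OccursAt v r z → ∀ a → r + a * p + p + p ≤ N → i + (r + a * p) + q ∈ H
  square-handle {z} {r} extremal wmin≢wmax |z|≡p occ a bound =
    Equivalence.from (H⇔handle k) (inside , inj₂ (wmin≢wmax , Sum.map move move extremal))
    where
    o = r + a * p
    k = i + o + q

    bound-v : o + p + p ≤ length v
    bound-v = subst (o + p + p ≤_) (sym |v|≡N) bound
    bound-N : o + length (z ++ z) ≤ N
    bound-N = subst (λ n → o + n ≤ N) (sym (trans (length-++ z) (cong₂ _+_ |z|≡p |z|≡p)))
                (subst (_≤ N) (+-assoc o p p) bound)
    bound-u : i + o + length (z ++ z) ≤ suc j
    bound-u = subst₂ _≤_ (sym (+-assoc i o (length (z ++ z)))) (m+[n∸m]≡n (≤-trans i≤j (n≤1+n j)))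
                (+-monoʳ-≤ i bound-N)

    square : OccursAt v o (z ++ z)
    square = occurs-square period (occurs-+periods period occ a bound-z) |z|≡p bound-v
      where
      bound-z : o + length z ≤ length v
      bound-z = subst (λ n → o + n ≤ length v) (sym |z|≡p) (m+n≤o⇒m≤o (o + p) bound-v)

    between : BetweenConsecOcc u i j z k
    between = square⇒between {u = u} {i} {j} {z} |z|≡p (occurs-factor {i = i} {j} square bound-N)
                (m≤m+n i o) bound-u
    inside : InsideInter i j k
    inside = between⇒inside {u = u} {i} {j} {z} (subst (1 ≤_) (sym |z|≡p) (s≤s z≤n)) between
    move : ∀ {x} → z ≡ x → BetweenConsecOcc u i j x k
    move refl = between

  handles-from-occurrences : wmin ≢ wmax → ∀ {r₁ r₂} → r₁ < p → OccursAt v r₁ wmin →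
                             r₂ < p → OccursAt v r₂ wmax → ∀ M → (2 + M) * p < N → M + M ≤ length H
  handles-from-occurrences wmin≢wmax {r₁} {r₂} r₁<p occ₁ r₂<p occ₂ M bound =
    disjoint-injections⇒length≥ (handle-at r₁) (handle-at r₂) M !H
      (handle-injective r₁) (handle-injective r₂) disjoint
      (λ {a} a<M → square-handle (inj₁ refl) wmin≢wmax |wmin|≡p occ₁ a (window-bound r₁<p a<M bound))
      (λ {a} a<M → square-handle (inj₂ refl) wmin≢wmax |wmax|≡p occ₂ a (window-bound r₂<p a<M bound))
    where
    handle-at : ℕ → ℕ → ℕ
    handle-at r a = i + (r + a * p) + q

    offsets-equal : ∀ r r′ a b → handle-at r a ≡ handle-at r′ b → r + a * p ≡ r′ + b * p
    offsets-equal r r′ a b e = +-cancelˡ-≡ i _ _ (+-cancelʳ-≡ q _ _ e)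

    handle-injective : ∀ r {a b} → handle-at r a ≡ handle-at r b → a ≡ b
    handle-injective r {a} {b} e = *-cancelʳ-≡ a b p (+-cancelˡ-≡ r _ _ (offsets-equal r r a b e))

    |wmin|≡p : length wmin ≡ p
    |wmin|≡p = trans (cyclic-length wmin-rot) |w|≡p
    |wmax|≡p : length wmax ≡ p
    |wmax|≡p = trans (cyclic-length wmax-rot) |w|≡p

    disjoint : ∀ a b → handle-at r₁ a ≢ handle-at r₂ b
    disjoint a b e with refl ← remainder-unique a b r₁<p r₂<p (offsets-equal r₁ r₂ a b e) =
      wmin≢wmax (occurrence-unique occ₁ occ₂ (trans |wmin|≡p (sym |wmax|≡p)))

  distinct-extremes⇒handles≥ : wmin ≢ wmax → ∀ M → (2 + M) * p < N → M + M ≤ length H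
  distinct-extremes⇒handles≥ wmin≢wmax
    with r₁ , r₁<p , occ₁ ← rotation-occurs period p+p≤|v| wmin-rot
       | r₂ , r₂<p , occ₂ ← rotation-occurs period p+p≤|v| wmax-rot =
    handles-from-occurrences wmin≢wmax r₁<p occ₁ r₂<p occ₂

lemma1 : {A : Set} (_<_ : Rel A 0ℓ) → IsStrictTotalOrder _≡_ _<_ →
         (u : List A) (i j p : ℕ) → IsRun u i j p →
         (wmin wmax : List A) →
         IsLexMinRot _<_ (take p (factor u i j)) wmin →
         IsLexMaxRot _<_ (take p (factor u i j)) wmax →
         (H : List ℕ) → Unique H →
         (∀ k → (k ∈ H) ⇔ IsHandle u i j wmin wmax k) →
         (p ≡ 1 → suc j ∸ i ≡ length H + 1)
         × (2 ≤ p → ∀ c → IsCeilDiv (suc j ∸ i) p c → 2 * c ≤ length H + 6)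
lemma1 _ sto u i j (suc q) (i≤j , j<u , (period@(s≤s z≤n , _) , _) , 2p≤N , _)
       wmin wmax (wmin-rot , _) (wmax-rot , _) H !H H⇔handle =
  period-one , period-at-least-two
  where
  open RunHandles i≤j j<u period 2p≤N wmin-rot wmax-rot !H H⇔handle

  period-one : suc q ≡ 1 → suc j ∸ i ≡ length H + 1
  period-one p≡1 =
    trans (equal-extremes⇒length≡1+handles (period-one⇒equal-extremes p≡1)) (+-comm 1 (length H))

  period-at-least-two : 2 ≤ suc q → ∀ c → IsCeilDiv (suc j ∸ i) (suc q) c → 2 * c ≤ length H + 6
  period-at-least-two 2≤p c ceil with ≡-dec (IsStrictTotalOrder._≟_ sto) wmin wmax
  ... | yes wmin≡wmax = begin
    2 * c                   ≤⟨ ceilDiv-≤-half 2≤p ceil ⟩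
    suc (suc j ∸ i)         ≡⟨ cong suc (equal-extremes⇒length≡1+handles wmin≡wmax) ⟩
    2 + length H            ≡⟨ +-comm 2 (length H) ⟩
    length H + 2            ≤⟨ +-monoʳ-≤ (length H) (m≤m+n 2 4) ⟩
    length H + 6            ∎
    where open ≤-Reasoning
  ... | no wmin≢wmax = ceil-bound c ceil
    where
    ceil-bound : ∀ c → IsCeilDiv (suc j ∸ i) (suc q) c → 2 * c ≤ length H + 6
    ceil-bound 0 _ = z≤n
    ceil-bound 1 _ = ≤-trans (m≤m+n 2 4) (m≤n+m 6 (length H))
    ceil-bound 2 _ = ≤-trans (m≤m+n 4 2) (m≤n+m 6 (length H))
    ceil-bound (suc (suc (suc M))) ceil =
      subst (_≤ length H + 6) (sym (double-three-plus M))
        (+-monoˡ-≤ 6 (distinct-extremes⇒handles≥ wmin≢wmax M (ceilDiv-pred< ceil)))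
      where
      double-three-plus : ∀ M → 2 * (3 + M) ≡ M + M + 6
      double-three-plus = solve-∀
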